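{- Let $\mathcal{R}$ be a discrete representable signature. If $s, s'$ are $\to_{\mathsf{rep}}$-normal terms with $s, s' \in \mathrm{Rep}(\mathcal{R})(\gamma;a)$ (same context $\gamma$ and type $a$), then $s \equiv s'$.
   Context: A representable signature consists of a set $\mathcal{A}$ of atoms and a multigraph $\mathcal{R}$ whose nodes (types) are generated by $a ::= o \in \mathcal{A} \mid (a_1 \otimes \cdots \otimes a_k)$ for $k \in \mathbb{N}$, with sets $\mathcal{R}(a_1,\dots,a_n;b)$ of multiarrows; it is discrete when it has no multiarrows. Representable terms (for discrete signatures): $s,t ::= x \mid \langle s_1,\dots,s_k\rangle \mid s[x_1^{a_1},\dots,x_k^{a_k} := t]$; in $s[\vec{x} := t]$ the $x_i$ are bound in $s$; terms up to renaming of bound variables. Typing rules: $x:a \vdash x:a$; if $\gamma_i \vdash s_i : a_i$ then $\gamma_1,\dots,\gamma_k \vdash \langle s_1,\dots,s_k\rangle : (a_1\otimes\cdots\otimes a_k)$; if $\gamma \vdash t : (a_1 \otimes\cdots\otimes a_k)$ and $\delta, x_1:a_1,\dots,x_k:a_k, \delta' \vdash s : b$ then $\delta,\gamma,\delta' \vdash s[x_1^{a_1},\dots,x_k^{a_k} := t] : b$; combined contexts are disjoint lists of distinct variables. $\mathrm{Rep}(\mathcal{R})(a_1,\dots,a_n;a)$ = terms $s$ with $x_1:a_1,\dots,x_n:a_n \vdash s : a$ (contexts up to renaming of variables). Contexts with one hole: $\mathtt{C} ::= [\cdot] \mid \langle s_1,\dots,\mathtt{C},\dots,s_k\rangle \mid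 \mathtt{C}[\vec{x}:=t] \mid s[\vec{x} := \mathtt{C}]$; $\mathtt{E}$ same grammar except that $s[\vec{x} := \mathtt{E}]$ requires $\mathtt{E} \neq [\cdot]$; $\mathtt{L} ::= [\cdot] \mid \mathtt{L}[\vec{x} := t]$; $\mathsf{LT}$ = terms $\mathtt{L}[\langle s_1,\dots,s_k\rangle]$. $\beta$: $s[x_1,\dots,x_k := \mathtt{L}[\langle t_1,\dots,t_k\rangle]] \to_\beta \mathtt{L}[s\{t_1/x_1,\dots,t_k/x_k\}]$ (capture-avoiding substitution), closed under $\mathtt{C}$-contexts; $\eta$: $s \to_\eta \langle x_1,\dots,x_k\rangle[x_1^{a_1},\dots,x_k^{a_k} := s]$ when $s$ has type $(a_1\otimes\cdots\otimes a_k)$, $x_i$ fresh, $s\notin\mathsf{LT}$, closed under $\mathtt{E}$-contexts; $\to_{\mathsf{rep}} = \to_\beta\cup\to_\eta$. Structural equivalence $\equiv$: smallest congruence containing $\mathtt{C}[s[\vec{x}:=t]] \equiv \mathtt{C}[s][\vec{x}:=t]$ whenever $\mathtt{C}$ binds no free variable of $t$ and $\vec{x}$ do not occur free in $\mathtt{C}$. -}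

module Defs where

-- Intrinsically typed, ordered-linear representable terms over a
-- discrete representable signature with atoms A (no multiarrows).
-- A term  Term γ a  is an element of Rep(R)(γ;a): variables are
-- nameless (positions in the ordered context γ), so terms are
-- automatically taken up to renaming of bound and free variables.

open import Data.List.Base using (List; []; _∷_; _++_; [_])
open import Data.List.Properties using (++-assoc; ++-identityʳ; ∷-injective)
open import Data.Product.Base using (Σ; _×_; _,_)
open import Data.Sum.Base using (_⊎_; inj₁; inj₂)
open import Data.Empty using (⊥)
open import Relation.Binary.PropositionalEquality using (_≡_; refl; sym; trans; cong)
open import Relation.Nullary using (¬_)

data Ty (A : Set) : Set where
  atom : A → Ty A
  ⊗ : List (Ty A) → Ty A

module _ {A : Set} where

  private
    Cx : Set
    Cx = List (Ty A)

  mutual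
    -- x : a ⊢ x : a
    -- γ₁,…,γₖ ⊢ ⟨s₁,…,sₖ⟩ : (a₁ ⊗ ⋯ ⊗ aₖ)
    -- δ,γ,δ' ⊢ s[x₁,…,xₖ := t] : b   (the xᵢ sit between δ and δ' in s's context)
    data Term : List (Ty A) → Ty A → Set where
      var  : (a : Ty A) → Term [ a ] a
      tup  : ∀ {γ as} → Tup γ as → Term γ (⊗ as)
      lett : ∀ (δ : Cx) {as γ : Cx} (δ' : Cx) {b} →
             Term (δ ++ as ++ δ') b → Term γ (⊗ as) → Term (δ ++ γ ++ δ') b

    data Tup : List (Ty A) → List (Ty A) → Set where
      []ᵗ  : Tup [] []
      _∷ᵗ_ : ∀ {γ δ a as} → Term γ a → Tup δ as → Tup (γ ++ δ) (a ∷ as)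

  infixr 5 _∷ᵗ_

  cast : ∀ {Γ Δ b} → Γ ≡ Δ → Term Δ b → Term Γ b
  cast refl s = s

  castᵗ : ∀ {Γ Δ as} → Γ ≡ Δ → Tup Δ as → Tup Γ as
  castᵗ refl s = s

  private
    nil≢ : ∀ (δ : Cx) {a δ'} → ¬ ([] ≡ δ ++ a ∷ δ')
    nil≢ [] ()
    nil≢ (_ ∷ _) ()

    split2 : ∀ (Γ₁ Γ₂ δ δ' : Cx) {a} → Γ₁ ++ Γ₂ ≡ δ ++ a ∷ δ' →
             (Σ Cx λ μ → (Γ₁ ≡ δ ++ a ∷ μ) × (δ' ≡ μ ++ Γ₂)) ⊎
             (Σ Cx λ μ → (Γ₂ ≡ μ ++ a ∷ δ') × (δ ≡ Γ₁ ++ μ))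
    split2 [] Γ₂ δ δ' e = inj₂ (δ , e , refl)
    split2 (x ∷ Γ₁) Γ₂ [] δ' refl = inj₁ (Γ₁ , refl , refl)
    split2 (x ∷ Γ₁) Γ₂ (y ∷ δ) δ' e with ∷-injective e
    ... | refl , e' with split2 Γ₁ Γ₂ δ δ' e'
    ... | inj₁ (μ , p , q) = inj₁ (μ , cong (x ∷_) p , q)
    ... | inj₂ (μ , p , q) = inj₂ (μ , p , cong (x ∷_) q)

    a3 : ∀ (x y z w : Cx) → (x ++ y ++ z) ++ w ≡ x ++ y ++ z ++ w
    a3 x y z w = trans (++-assoc x (y ++ z) w) (cong (x ++_) (++-assoc y z w))

    re : ∀ (δ μ x μ' δ' : Cx) → δ ++ (μ ++ x ++ μ') ++ δ' ≡ (δ ++ μ) ++ x ++ μ' ++ δ'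
    re δ μ x μ' δ' =
      trans (cong (δ ++_) (a3 μ x μ' δ')) (sym (++-assoc δ μ (x ++ μ' ++ δ')))

  mutual
    sub1 : ∀ (δ δ' : Cx) {Γ a b γ} → Term Γ b → Γ ≡ δ ++ a ∷ δ' → Term γ a →
           Term (δ ++ γ ++ δ') b
    sub1 [] δ' {γ = γ} (var _) refl u = cast (++-identityʳ γ) u
    sub1 (x ∷ δ) δ' (var _) e u with nil≢ δ (proj₂ (∷-injective e))
      where open import Data.Product.Base using (proj₂)
    ... | ()
    sub1 δ δ' (tup ts) e u = tup (subT δ δ' ts e u)
    sub1 δ δ' {a = a} {γ = γ} (lett D {as'} {γt} D' body arg) e u
      with split2 D (γt ++ D') δ δ' e
    ... | inj₁ (μ , refl , refl) =
      cast (sym (a3 δ γ μ (γt ++ D')))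
        (lett (δ ++ γ ++ μ) D'
          (cast (a3 δ γ μ (as' ++ D'))
            (sub1 δ (μ ++ as' ++ D') body (a3' δ a μ (as' ++ D')) u))
          arg)
      where
        a3' : ∀ (x : Cx) y (z w : Cx) → (x ++ y ∷ z) ++ w ≡ x ++ y ∷ z ++ w
        a3' x y z w = ++-assoc x (y ∷ z) w
    ... | inj₂ (μ , e₂ , refl) with split2 γt D' μ δ' e₂
    ...   | inj₁ (ν , refl , refl) =
      cast (trans (++-assoc D μ (γ ++ ν ++ D'))
                  (cong (D ++_) (sym (a3 μ γ ν D'))))
        (lett D D' body (sub1 μ ν arg refl u))
    ...   | inj₂ (ν , refl , refl) =
      cast (a3 D γt ν (γ ++ δ'))
        (lett D (ν ++ γ ++ δ')
          (cast (sym (a3 D as' ν (γ ++ δ')))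
            (sub1 (D ++ as' ++ ν) δ' body (sym (a3 D as' ν (a ∷ δ'))) u))
          arg)

    subT : ∀ (δ δ' : Cx) {Γ a as γ} → Tup Γ as → Γ ≡ δ ++ a ∷ δ' → Term γ a →
           Tup (δ ++ γ ++ δ') as
    subT δ δ' []ᵗ e u with nil≢ δ e
    ... | ()
    subT δ δ' {γ = γ} (_∷ᵗ_ {γ₁} {γ₂} t ts) e u with split2 γ₁ γ₂ δ δ' e
    ... | inj₁ (μ , p , refl) = castᵗ (sym (a3 δ γ μ γ₂)) (sub1 δ μ t p u ∷ᵗ ts)
    ... | inj₂ (μ , p , refl) =
      castᵗ (++-assoc γ₁ μ (γ ++ δ')) (t ∷ᵗ subT μ δ' ts p u)

  subB : ∀ (δ δ' : Cx) {as γ b} → Term (δ ++ as ++ δ') b → Tup γ as →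
         Term (δ ++ γ ++ δ') b
  subB δ δ' s []ᵗ = s
  subB δ δ' {a ∷ as'} s (_∷ᵗ_ {γ₁} {γ₂} t ts) =
    cast (trans (cong (δ ++_) (++-assoc γ₁ γ₂ δ')) (sym (++-assoc δ γ₁ (γ₂ ++ δ'))))
      (subB (δ ++ γ₁) δ'
        (cast (++-assoc δ γ₁ (as' ++ δ')) (sub1 δ (as' ++ δ') s refl t))
        ts)

  -- L-contexts  L ::= [·] | L[x⃗ := t]   (hole context Φ, outer context Γ)

  data LCtx : List (Ty A) → List (Ty A) → Set where
    ∙   : ∀ {Φ} → LCtx Φ Φ
    ext : ∀ {Φ} (μ μ' : Cx) {bs ν} → LCtx Φ (μ ++ bs ++ μ') → Term ν (⊗ bs) →
          LCtx Φ (μ ++ ν ++ μ')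

  plugL : ∀ {Φ Γ c} → LCtx Φ Γ → Term Φ c → Term Γ c
  plugL ∙ r = r
  plugL (ext μ μ' L u) r = lett μ μ' (plugL L r) u

  plugLpad : ∀ (δ δ' : Cx) {Φ Γ c} → LCtx Φ Γ → Term (δ ++ Φ ++ δ') c →
             Term (δ ++ Γ ++ δ') c
  plugLpad δ δ' ∙ r = r
  plugLpad δ δ' (ext μ μ' {bs} {ν} L u) r =
    cast (re δ μ ν μ' δ')
      (lett (δ ++ μ) (μ' ++ δ') (cast (sym (re δ μ bs μ' δ')) (plugLpad δ δ' L r)) u)

  data IsLT : ∀ {Γ b} → Term Γ b → Set where
    ltTup : ∀ {γ as} {ts : Tup γ as} → IsLT (tup ts)
    ltLet : ∀ {δ δ' as γ b} {s : Term (δ ++ as ++ δ') b} {t : Term γ (⊗ as)} →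
            IsLT s → IsLT (lett δ δ' s t)

  mutual
    data _→β_ : ∀ {Γ b} → Term Γ b → Term Γ b → Set where
      β-root : ∀ (δ δ' : Cx) {Φ γ as b} (s : Term (δ ++ as ++ δ') b)
               (L : LCtx Φ γ) (ts : Tup Φ as) →
               lett δ δ' s (plugL L (tup ts)) →β plugLpad δ δ' L (subB δ δ' s ts)
      β-tup  : ∀ {γ as} {ts ts' : Tup γ as} → ts →βᵗ ts' → tup ts →β tup ts'
      β-body : ∀ {δ δ' as γ b} {s s' : Term (δ ++ as ++ δ') b} {t : Term γ (⊗ as)} →
               s →β s' → lett δ δ' s t →β lett δ δ' s' t
      β-arg  : ∀ {δ δ' as γ b} {s : Term (δ ++ as ++ δ') b} {t t' : Term γ (⊗ as)} →
               t →β t' → lett δ δ' s t →β lett δ δ' s t'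

    data _→βᵗ_ : ∀ {Γ as} → Tup Γ as → Tup Γ as → Set where
      here  : ∀ {γ δ a as} {t t' : Term γ a} {ts : Tup δ as} →
              t →β t' → (t ∷ᵗ ts) →βᵗ (t' ∷ᵗ ts)
      there : ∀ {γ δ a as} {t : Term γ a} {ts ts' : Tup δ as} →
              ts →βᵗ ts' → (t ∷ᵗ ts) →βᵗ (t ∷ᵗ ts')

  idTup : (as : Cx) → Tup (as ++ []) as
  idTup [] = []ᵗ
  idTup (a ∷ as) = var a ∷ᵗ idTup as

  etaExp : ∀ {γ as} → Term γ (⊗ as) → Term γ (⊗ as)
  etaExp {γ} {as} s = cast (sym (++-identityʳ γ)) (lett [] [] (tup (idTup as)) s)

  mutual
    -- steps under an arbitrary E-context
    data _→η_ : ∀ {Γ b} → Term Γ b → Term Γ b → Set where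
      η-root : ∀ {γ as} (s : Term γ (⊗ as)) → ¬ IsLT s → s →η etaExp s
      η-deep : ∀ {Γ b} {s s' : Term Γ b} → s →η⁺ s' → s →η s'

    -- steps under an E-context different from [·]
    data _→η⁺_ : ∀ {Γ b} → Term Γ b → Term Γ b → Set where
      η-tup  : ∀ {γ as} {ts ts' : Tup γ as} → ts →ηᵗ ts' → tup ts →η⁺ tup ts'
      η-body : ∀ {δ δ' as γ b} {s s' : Term (δ ++ as ++ δ') b} {t : Term γ (⊗ as)} →
               s →η s' → lett δ δ' s t →η⁺ lett δ δ' s' t
      η-arg  : ∀ {δ δ' as γ b} {s : Term (δ ++ as ++ δ') b} {t t' : Term γ (⊗ as)} →
               t →η⁺ t' → lett δ δ' s t →η⁺ lett δ δ' s t'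

    data _→ηᵗ_ : ∀ {Γ as} → Tup Γ as → Tup Γ as → Set where
      here  : ∀ {γ δ a as} {t t' : Term γ a} {ts : Tup δ as} →
              t →η t' → (t ∷ᵗ ts) →ηᵗ (t' ∷ᵗ ts)
      there : ∀ {γ δ a as} {t : Term γ a} {ts ts' : Tup δ as} →
              ts →ηᵗ ts' → (t ∷ᵗ ts) →ηᵗ (t ∷ᵗ ts')

  _→rep_ : ∀ {Γ b} → Term Γ b → Term Γ b → Set
  s →rep s' = (s →β s') ⊎ (s →η s')

  Normal : ∀ {Γ b} → Term Γ b → Set
  Normal s = ∀ s' → ¬ (s →rep s')

  -- one-hole C-contexts that bind no variable of a distinguished
  -- segment θ of the hole's context: hole context Φ₁ ++ θ ++ Φ₂ (type b),
  -- outer context Γ₁ ++ θ ++ Γ₂ (type c), for every θ.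

  appᵗ : ∀ {Λ Ρ as bs} → Tup Λ as → Tup Ρ bs → Tup (Λ ++ Ρ) (as ++ bs)
  appᵗ []ᵗ rs = rs
  appᵗ {Ρ = Ρ} (_∷ᵗ_ {γ₁} {γ₂} t ts) rs = castᵗ (++-assoc γ₁ γ₂ Ρ) (t ∷ᵗ appᵗ ts rs)

  data PCtx (Φ₁ Φ₂ : List (Ty A)) (b : Ty A) :
            List (Ty A) → List (Ty A) → Ty A → Set where
    hole  : PCtx Φ₁ Φ₂ b Φ₁ Φ₂ b
    tupC  : ∀ {Λ Ρ as bs Γ₁ Γ₂ a} → Tup Λ as → PCtx Φ₁ Φ₂ b Γ₁ Γ₂ a → Tup Ρ bs →
            PCtx Φ₁ Φ₂ b (Λ ++ Γ₁) (Γ₂ ++ Ρ) (⊗ (as ++ a ∷ bs))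
    argC  : ∀ (δ δ' : Cx) {as Γ₁ Γ₂ c} → Term (δ ++ as ++ δ') c →
            PCtx Φ₁ Φ₂ b Γ₁ Γ₂ (⊗ as) → PCtx Φ₁ Φ₂ b (δ ++ Γ₁) (Γ₂ ++ δ') c
    -- C[x⃗ := t], x⃗ bound to the left of θ
    bodyL : ∀ (δ μ : Cx) {as ν Γ₂ c} → PCtx Φ₁ Φ₂ b (δ ++ as ++ μ) Γ₂ c →
            Term ν (⊗ as) → PCtx Φ₁ Φ₂ b (δ ++ ν ++ μ) Γ₂ c
    -- C[x⃗ := t], x⃗ bound to the right of θ
    bodyR : ∀ (μ δ' : Cx) {as ν Γ₁ c} → PCtx Φ₁ Φ₂ b Γ₁ (μ ++ as ++ δ') c →
            Term ν (⊗ as) → PCtx Φ₁ Φ₂ b Γ₁ (μ ++ ν ++ δ') c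

  plugP : ∀ (θ : Cx) {Φ₁ Φ₂ b Γ₁ Γ₂ c} → PCtx Φ₁ Φ₂ b Γ₁ Γ₂ c →
          Term (Φ₁ ++ θ ++ Φ₂) b → Term (Γ₁ ++ θ ++ Γ₂) c
  plugP θ hole r = r
  plugP θ (tupC {Λ} {Ρ} {Γ₁ = Γ₁} {Γ₂} ls C rs) r =
    tup (castᵗ (trans (++-assoc Λ Γ₁ (θ ++ Γ₂ ++ Ρ))
                 (cong (Λ ++_) (sym (a3 Γ₁ θ Γ₂ Ρ))))
          (appᵗ ls (plugP θ C r ∷ᵗ rs)))
  plugP θ (argC δ δ' {Γ₁ = Γ₁} {Γ₂} s C) r =
    cast (trans (++-assoc δ Γ₁ (θ ++ Γ₂ ++ δ'))
                (cong (δ ++_) (sym (a3 Γ₁ θ Γ₂ δ'))))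
      (lett δ δ' s (plugP θ C r))
  plugP θ (bodyL δ μ {as} {ν} {Γ₂} C t) r =
    cast (a3 δ ν μ (θ ++ Γ₂))
      (lett δ (μ ++ θ ++ Γ₂) (cast (sym (a3 δ as μ (θ ++ Γ₂))) (plugP θ C r)) t)
  plugP θ (bodyR μ δ' {as} {ν} {Γ₁} C t) r =
    cast (sym (a3 Γ₁ θ μ (ν ++ δ')))
      (lett (Γ₁ ++ θ ++ μ) δ' (cast (a3 Γ₁ θ μ (as ++ δ')) (plugP θ C r)) t)

  -- structural equivalence ≡ : smallest congruence containing
  --   C[s[x⃗ := t]] ≡ C[s][x⃗ := t]   (C binds no free variable of t)

  mutual
    data _≈_ : ∀ {Γ b} → Term Γ b → Term Γ b → Set where
      ≈-refl  : ∀ {Γ b} {s : Term Γ b} → s ≈ s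
      ≈-sym   : ∀ {Γ b} {s s' : Term Γ b} → s ≈ s' → s' ≈ s
      ≈-trans : ∀ {Γ b} {s s' s'' : Term Γ b} → s ≈ s' → s' ≈ s'' → s ≈ s''
      ≈-tup   : ∀ {γ as} {ts ts' : Tup γ as} → ts ≈ᵗ ts' → tup ts ≈ tup ts'
      ≈-let   : ∀ {δ δ' as γ b} {s s' : Term (δ ++ as ++ δ') b} {t t' : Term γ (⊗ as)} →
                s ≈ s' → t ≈ t' → lett δ δ' s t ≈ lett δ δ' s' t'
      ≈-comm  : ∀ {Φ₁ Φ₂ b Γ₁ Γ₂ c as γ} (C : PCtx Φ₁ Φ₂ b Γ₁ Γ₂ c)
                (s : Term (Φ₁ ++ as ++ Φ₂) b) (t : Term γ (⊗ as)) →
                plugP γ C (lett Φ₁ Φ₂ s t) ≈ lett Γ₁ Γ₂ (plugP as C s) t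
      -- representation artefact: a let binding no variable to a closed
      -- term has no determined position in the ordered context; all
      -- positions denote the same (named) term
      ≈-pos   : ∀ (δ δ' μ μ' : Cx) {b} (e : μ ++ μ' ≡ δ ++ δ')
                (s : Term (δ ++ δ') b) (t : Term [] (⊗ [])) →
                lett δ δ' s t ≈ cast (sym e) (lett μ μ' (cast e s) t)

    data _≈ᵗ_ : ∀ {Γ as} → Tup Γ as → Tup Γ as → Set where
      []ᵗ  : []ᵗ ≈ᵗ []ᵗ
      _∷ᵗ_ : ∀ {γ δ a as} {t t' : Term γ a} {ts ts' : Tup δ as} →
             t ≈ t' → ts ≈ᵗ ts' → (t ∷ᵗ ts) ≈ᵗ (t' ∷ᵗ ts')

module Submission where

-- In a →rep-normal term a let whose argument lies in LT is a β-redex, and η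
-- applies to every tensor-typed subterm outside LT except the argument of a
-- let. An argument u[y⃗ := t'] is either in LT or has an η-expandable body u,
-- so normal terms are atom variables, tuples of normal terms, and lets
-- s[x⃗ := y] unpacking a variable y. Up to ≡ the unpacking of any chosen
-- tensor variable of the context can be floated to the root, leaving a normal
-- body over a context with one ⊗ fewer. Two normal terms of the same type in
-- the same context can therefore be made to unpack the same variable first,
-- and by induction on the number of ⊗ in the context we reach a context of
-- atoms, where a normal term is the η-long tuple of its variables and hence
-- determined by its type.

open import Defs
open import Data.List.Base using (List; []; _∷_; _++_; [_])
open import Data.List.Properties using (++-assoc; ∷-injective)
open import Data.List.Relation.Unary.All using (All; []; _∷_)
open import Data.List.Relation.Unary.All.Properties using (++⁻ˡ; ++⁻ʳ)
open import Data.Product.Base using (Σ; _×_; _,_; proj₂)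
open import Data.Sum.Base using (_⊎_; inj₁; inj₂)
open import Data.Empty using (⊥-elim)
open import Data.Nat.Base using (ℕ; suc; _+_; _<_)
open import Data.Nat.Properties using (+-assoc; +-monoʳ-<; n<1+n)
open import Data.Nat.Induction using (<-wellFounded)
open import Induction.WellFounded using (Acc; acc)
open import Relation.Binary.PropositionalEquality
  using (_≡_; refl; sym; trans; cong)
open import Relation.Binary.HeterogeneousEquality as H using (_≅_; ≅-to-≡)
open import Axiom.UniquenessOfIdentityProofs.WithK using (uip)
open import Relation.Nullary using (¬_)

module _ {A : Set} where

  private
    Cx : Set
    Cx = List (Ty A)

  mutual
    data Nf : ∀ {Γ : Cx} {b} → Term Γ b → Set where
      nf-var    : (o : A) → Nf (var (atom o))
      nf-tup    : ∀ {γ : Cx} {as} {ts : Tup γ as} → Nfᵗ ts → Nf (tup ts)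
      nf-unpack : ∀ {δ δ' as : Cx} {b} {s : Term (δ ++ as ++ δ') b} → Nf s →
                  Nf (lett δ δ' s (var (⊗ as)))

    data Nfᵗ : ∀ {Γ : Cx} {as} → Tup Γ as → Set where
      []  : Nfᵗ []ᵗ
      _∷_ : ∀ {γ δ : Cx} {a as} {t : Term γ a} {ts : Tup δ as} →
            Nf t → Nfᵗ ts → Nfᵗ (t ∷ᵗ ts)

  IsLT-view : ∀ {Γ : Cx} {as} (s : Term Γ (⊗ as)) →
              (Σ Cx λ Φ → Σ (LCtx Φ Γ) λ L → Σ (Tup Φ as) λ ts → s ≡ plugL L (tup ts))
              ⊎ ¬ IsLT s
  IsLT-view (var _) = inj₂ λ ()
  IsLT-view (tup ts) = inj₁ (_ , ∙ , ts , refl)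
  IsLT-view (lett μ μ' s t) with IsLT-view s
  ... | inj₁ (Φ , L , ts , refl) = inj₁ (Φ , ext μ μ' L t , ts , refl)
  ... | inj₂ ¬lt = inj₂ λ { (ltLet lt) → ¬lt lt }

  Normalᵗ : ∀ {Γ : Cx} {as} → Tup Γ as → Set
  Normalᵗ ts = ∀ ts' → ¬ ((ts →βᵗ ts') ⊎ (ts →ηᵗ ts'))

  mutual
    normal⇒Nf : ∀ {Γ : Cx} {b} (s : Term Γ b) → Normal s → Nf s
    normal⇒Nf (var (atom o)) _ = nf-var o
    normal⇒Nf (var (⊗ as)) n = ⊥-elim (n _ (inj₂ (η-root (var _) λ ())))
    normal⇒Nf (tup ts) n = nf-tup (normalᵗ⇒Nfᵗ ts λ
      { _ (inj₁ r) → n _ (inj₁ (β-tup r))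
      ; _ (inj₂ r) → n _ (inj₂ (η-deep (η-tup r))) })
    normal⇒Nf (lett δ δ' s (var _)) n = nf-unpack (normal⇒Nf s λ
      { _ (inj₁ r) → n _ (inj₁ (β-body r))
      ; _ (inj₂ r) → n _ (inj₂ (η-deep (η-body r))) })
    normal⇒Nf (lett δ δ' s (tup ts)) n = ⊥-elim (n _ (inj₁ (β-root δ δ' s ∙ ts)))
    normal⇒Nf (lett δ δ' s (lett μ μ' u t)) n with IsLT-view u
    ... | inj₁ (_ , L , ts , refl) = ⊥-elim (n _ (inj₁ (β-root δ δ' s (ext μ μ' L t) ts)))
    ... | inj₂ ¬lt = ⊥-elim (n _ (inj₂ (η-deep (η-arg (η-body (η-root u ¬lt))))))

    normalᵗ⇒Nfᵗ : ∀ {Γ : Cx} {as} (ts : Tup Γ as) → Normalᵗ ts → Nfᵗ ts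
    normalᵗ⇒Nfᵗ []ᵗ _ = []
    normalᵗ⇒Nfᵗ (t ∷ᵗ ts) n =
      normal⇒Nf t (λ { _ (inj₁ r) → n _ (inj₁ (here r))
                     ; _ (inj₂ r) → n _ (inj₂ (here r)) })
      ∷ normalᵗ⇒Nfᵗ ts (λ { _ (inj₁ r) → n _ (inj₁ (there r))
                          ; _ (inj₂ r) → n _ (inj₂ (there r)) })

  cast-refl : ∀ {Γ : Cx} {b} (e : Γ ≡ Γ) (s : Term Γ b) → cast e s ≡ s
  cast-refl refl s = refl

  cast-irrelevant : ∀ {Γ Δ : Cx} {b} (e e' : Γ ≡ Δ) (s : Term Δ b) → cast e s ≡ cast e' s
  cast-irrelevant e e' s rewrite uip e e' = refl

  castᵗ-refl : ∀ {Γ : Cx} {as} (e : Γ ≡ Γ) (ts : Tup Γ as) → castᵗ e ts ≡ ts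
  castᵗ-refl refl ts = refl

  castᵗ-trans : ∀ {Γ Δ Ω : Cx} {as} (p : Γ ≡ Ω) (e : Γ ≡ Δ) (g : Δ ≡ Ω) (ts : Tup Ω as) →
                castᵗ p ts ≡ castᵗ e (castᵗ g ts)
  castᵗ-trans p refl refl ts = castᵗ-refl p ts

  castᵗ-≅ : ∀ {Γ Δ : Cx} {as} (e : Γ ≡ Δ) (ts : Tup Δ as) → castᵗ e ts ≅ ts
  castᵗ-≅ refl ts = H.refl

  ≅⇒≡castᵗ : ∀ {Γ Δ : Cx} {as} (e : Γ ≡ Δ) {ts : Tup Γ as} {ts' : Tup Δ as} →
             ts ≅ ts' → ts ≡ castᵗ e ts'
  ≅⇒≡castᵗ refl h = ≅-to-≡ h

  tup-castᵗ : ∀ {Γ Δ : Cx} {as} (e : Γ ≡ Δ) (ts : Tup Δ as) → tup (castᵗ e ts) ≡ cast e (tup ts)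
  tup-castᵗ refl ts = refl

  Nf-cast : ∀ {Γ Δ : Cx} {b} (e : Γ ≡ Δ) {s : Term Δ b} → Nf s → Nf (cast e s)
  Nf-cast refl n = n

  Nfᵗ-castᵗ : ∀ {Γ Δ : Cx} {as} (e : Γ ≡ Δ) {ts : Tup Δ as} → Nfᵗ ts → Nfᵗ (castᵗ e ts)
  Nfᵗ-castᵗ refl n = n

  Nfᵗ-appᵗ : ∀ {Λ Ρ : Cx} {as bs} {ls : Tup Λ as} {rs : Tup Ρ bs} →
             Nfᵗ ls → Nfᵗ rs → Nfᵗ (appᵗ ls rs)
  Nfᵗ-appᵗ [] nrs = nrs
  Nfᵗ-appᵗ (nl ∷ nls) nrs = Nfᵗ-castᵗ _ (nl ∷ Nfᵗ-appᵗ nls nrs)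

  ≈-reflexive : ∀ {Γ : Cx} {b} {s s' : Term Γ b} → s ≡ s' → s ≈ s'
  ≈-reflexive refl = ≈-refl

  ≈-cast : ∀ {Γ Δ : Cx} {b} (e : Γ ≡ Δ) {s s' : Term Δ b} → s ≈ s' → cast e s ≈ cast e s'
  ≈-cast refl p = p

  ≈-cast-transpose : ∀ {Γ Δ : Cx} {b} (e : Γ ≡ Δ) (e' : Δ ≡ Γ) {s : Term Δ b} {s' : Term Γ b} →
                     cast e s ≈ s' → s ≈ cast e' s'
  ≈-cast-transpose refl e' {s' = s'} p rewrite cast-refl e' s' = p

  ≈ᵗ-refl : ∀ {Γ : Cx} {as} (ts : Tup Γ as) → ts ≈ᵗ ts
  ≈ᵗ-refl []ᵗ = []ᵗ
  ≈ᵗ-refl (t ∷ᵗ ts) = ≈-refl ∷ᵗ ≈ᵗ-refl ts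

  ≈ᵗ-castᵗ : ∀ {Γ Δ : Cx} {as} (e : Γ ≡ Δ) {ts ts' : Tup Δ as} →
             ts ≈ᵗ ts' → castᵗ e ts ≈ᵗ castᵗ e ts'
  ≈ᵗ-castᵗ refl p = p

  ≈ᵗ-appᵗ : ∀ {Λ Ρ : Cx} {as bs} (ls : Tup Λ as) {rs rs' : Tup Ρ bs} → rs ≈ᵗ rs' →
            appᵗ ls rs ≈ᵗ appᵗ ls rs'
  ≈ᵗ-appᵗ []ᵗ p = p
  ≈ᵗ-appᵗ (l ∷ᵗ ls) p = ≈ᵗ-castᵗ _ (≈-refl ∷ᵗ ≈ᵗ-appᵗ ls p)

  ++-assoc³ : ∀ (x y z w : Cx) → (x ++ y ++ z) ++ w ≡ x ++ y ++ z ++ w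
  ++-assoc³ x y z w = trans (++-assoc x (y ++ z) w) (cong (x ++_) (++-assoc y z w))

  nil≢ : ∀ (δ : Cx) {a δ'} → ¬ ([] ≡ δ ++ a ∷ δ')
  nil≢ [] ()
  nil≢ (_ ∷ _) ()

  split-++ : ∀ (Γ₁ Γ₂ δ δ' : Cx) {a} → Γ₁ ++ Γ₂ ≡ δ ++ a ∷ δ' →
             (Σ Cx λ μ → (Γ₁ ≡ δ ++ a ∷ μ) × (δ' ≡ μ ++ Γ₂)) ⊎
             (Σ Cx λ μ → (Γ₂ ≡ μ ++ a ∷ δ') × (δ ≡ Γ₁ ++ μ))
  split-++ [] Γ₂ δ δ' e = inj₂ (δ , e , refl)
  split-++ (x ∷ Γ₁) Γ₂ [] δ' refl = inj₁ (Γ₁ , refl , refl)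
  split-++ (x ∷ Γ₁) Γ₂ (y ∷ δ) δ' e with ∷-injective e
  ... | refl , e' with split-++ Γ₁ Γ₂ δ δ' e'
  ... | inj₁ (μ , p , q) = inj₁ (μ , cong (x ∷_) p , q)
  ... | inj₂ (μ , p , q) = inj₂ (μ , p , cong (x ∷_) q)

  split-∷ : ∀ (D D' δ δ' : Cx) {x y} → D ++ x ∷ D' ≡ δ ++ y ∷ δ' →
            ((D ≡ δ) × (x ≡ y) × (D' ≡ δ')) ⊎
            ((Σ Cx λ μ → (D ≡ δ ++ y ∷ μ) × (δ' ≡ μ ++ x ∷ D')) ⊎
             (Σ Cx λ μ → (D' ≡ μ ++ y ∷ δ') × (δ ≡ D ++ x ∷ μ)))
  split-∷ [] D' [] δ' refl = inj₁ (refl , refl , refl)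
  split-∷ [] D' (z ∷ δ) δ' refl = inj₂ (inj₂ (δ , refl , refl))
  split-∷ (z ∷ D) D' [] δ' refl = inj₂ (inj₁ (D , refl , refl))
  split-∷ (z ∷ D) D' (w ∷ δ) δ' e with ∷-injective e
  ... | refl , e' with split-∷ D D' δ δ' e'
  ... | inj₁ (p , q , r) = inj₁ (cong (z ∷_) p , q , r)
  ... | inj₂ (inj₁ (μ , p , q)) = inj₂ (inj₁ (μ , cong (z ∷_) p , q))
  ... | inj₂ (inj₂ (μ , p , q)) = inj₂ (inj₂ (μ , p , cong (z ∷_) q))

  Unpacked : ∀ {Γ : Cx} {b} → Term Γ b → (δ as δ' : Cx) → Γ ≡ δ ++ ⊗ as ∷ δ' → Set
  Unpacked {b = b} s δ as δ' e =
    Σ (Term (δ ++ as ++ δ') b) λ N → Nf N × (s ≈ cast e (lett δ δ' N (var (⊗ as))))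

  record Unpackedᵗ {Γ cs} (ts : Tup Γ cs) (δ as δ' : Cx) : Set where
    field
      {Λ Ρ cs₁ cs₂ μ μ'} : Cx
      {c} : Ty A
      ls : Tup Λ cs₁
      t  : Term (μ ++ ⊗ as ∷ μ') c
      rs : Tup Ρ cs₂
      ls-nf : Nfᵗ ls
      rs-nf : Nfᵗ rs
      t-unpacked : Unpacked t μ as μ' refl
      cs≡ : cs ≡ cs₁ ++ c ∷ cs₂
      δ≡  : δ ≡ Λ ++ μ
      δ'≡ : δ' ≡ μ' ++ Ρ
      Γ≡  : Γ ≡ Λ ++ (μ ++ ⊗ as ∷ μ') ++ Ρ
      ts≅ : ts ≅ appᵗ ls (t ∷ᵗ rs)

  Unpackedᵗ-∷ : ∀ {γ Γ μ as δ' : Cx} {a cs} {t : Term γ a} {ts : Tup Γ cs} →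
                Nf t → Unpackedᵗ ts μ as δ' → Unpackedᵗ (t ∷ᵗ ts) (γ ++ μ) as δ'
  Unpackedᵗ-∷ {γ} {t = t} nt record
    { Λ = Λ ; μ = μ ; ls = ls ; t = u ; rs = rs ; ls-nf = ls-nf ; rs-nf = rs-nf
    ; t-unpacked = u-unpacked ; cs≡ = refl ; δ≡ = refl ; δ'≡ = δ'≡ ; Γ≡ = refl ; ts≅ = ts≅ }
    = record
    { ls = t ∷ᵗ ls ; t = u ; rs = rs ; ls-nf = nt ∷ ls-nf ; rs-nf = rs-nf
    ; t-unpacked = u-unpacked ; cs≡ = refl ; δ≡ = sym (++-assoc γ Λ μ) ; δ'≡ = δ'≡
    ; Γ≡ = sym (++-assoc γ Λ _)
    ; ts≅ = H.trans (H.cong (t ∷ᵗ_) ts≅) (H.sym (castᵗ-≅ _ _)) }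

  unpack-tup : ∀ {Γ δ as δ' : Cx} {cs} {ts : Tup Γ cs} → Unpackedᵗ ts δ as δ' →
               (e : Γ ≡ δ ++ ⊗ as ∷ δ') → Unpacked (tup ts) δ as δ' e
  unpack-tup {as = as} record
    { μ = μ ; μ' = μ' ; c = c ; ls = ls ; t = t ; rs = rs ; ls-nf = ls-nf ; rs-nf = rs-nf
    ; t-unpacked = N , N-nf , t≈ ; cs≡ = refl ; δ≡ = refl ; δ'≡ = refl ; Γ≡ = Γ≡ ; ts≅ = ts≅ } e
    = plugP as C N , nf-tup (Nfᵗ-castᵗ _ (Nfᵗ-appᵗ ls-nf (N-nf ∷ rs-nf))) ,
      ≈-trans (≈-reflexive (cong tup (≅⇒≡castᵗ Γ≡ ts≅)))
        (≈-trans (≈-tup (≈ᵗ-castᵗ Γ≡ (≈ᵗ-appᵗ ls (t≈ ∷ᵗ ≈ᵗ-refl rs))))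
          (≈-trans (≈-reflexive (trans (cong tup (castᵗ-trans Γ≡ e _ _)) (tup-castᵗ e _)))
            (≈-cast e (≈-comm C N (var (⊗ as))))))
    where C = tupC {Φ₁ = μ} {Φ₂ = μ'} {b = c} ls hole rs

  unpack-before : ∀ (δ μ D' : Cx) {as bs b e'} {s : Term ((δ ++ ⊗ as ∷ μ) ++ bs ++ D') b} →
                  Unpacked s δ as (μ ++ bs ++ D') e' →
                  (e : (δ ++ ⊗ as ∷ μ) ++ ⊗ bs ∷ D' ≡ δ ++ ⊗ as ∷ μ ++ ⊗ bs ∷ D') →
                  Unpacked (lett (δ ++ ⊗ as ∷ μ) D' s (var (⊗ bs))) δ as (μ ++ ⊗ bs ∷ D') e
  unpack-before δ μ D' {as} {bs} {b} {e'} (N , N-nf , s≈) e =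
    plugP as C N , Nf-cast _ (nf-unpack (Nf-cast _ N-nf)) ,
    ≈-trans (≈-let s≈ ≈-refl)
      (≈-cast-transpose _ e
        (≈-trans (≈-reflexive (cong (λ z → cast _ (lett (δ ++ ⊗ as ∷ μ) D' z (var (⊗ bs))))
                                    (cast-irrelevant e' _ (lett δ (μ ++ bs ++ D') N (var (⊗ as))))))
                 (≈-comm C N (var (⊗ as)))))
    where C = bodyR {Φ₁ = δ} {Φ₂ = μ ++ bs ++ D'} {b = b} μ D' {bs} {[ ⊗ bs ]} hole (var (⊗ bs))

  unpack-after : ∀ (D μ δ' : Cx) {as bs b e'} {s : Term (D ++ bs ++ μ ++ ⊗ as ∷ δ') b} →
                 Unpacked s (D ++ bs ++ μ) as δ' e' →
                 (e : D ++ ⊗ bs ∷ μ ++ ⊗ as ∷ δ' ≡ (D ++ ⊗ bs ∷ μ) ++ ⊗ as ∷ δ') →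
                 Unpacked (lett D (μ ++ ⊗ as ∷ δ') s (var (⊗ bs))) (D ++ ⊗ bs ∷ μ) as δ' e
  unpack-after D μ δ' {as} {bs} {b} {e'} (N , N-nf , s≈) e =
    plugP as C N , Nf-cast _ (nf-unpack (Nf-cast _ N-nf)) ,
    ≈-trans (≈-let s≈ ≈-refl)
      (≈-cast-transpose _ e
        (≈-trans (≈-reflexive (cong (λ z → cast _ (lett D (μ ++ ⊗ as ∷ δ') z (var (⊗ bs))))
                                    (cast-irrelevant e' _ (lett (D ++ bs ++ μ) δ' N (var (⊗ as))))))
                 (≈-comm C N (var (⊗ as)))))
    where C = bodyL {Φ₁ = D ++ bs ++ μ} {Φ₂ = δ'} {b = b} D μ {bs} {[ ⊗ bs ]} hole (var (⊗ bs))

  mutual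
    unpack : ∀ {Γ : Cx} {b} {s : Term Γ b} → Nf s →
             ∀ δ as δ' (e : Γ ≡ δ ++ ⊗ as ∷ δ') → Unpacked s δ as δ' e
    unpack (nf-var o) [] as δ' ()
    unpack (nf-var o) (_ ∷ δ) as δ' e = ⊥-elim (nil≢ δ (proj₂ (∷-injective e)))
    unpack (nf-tup nts) δ as δ' e = unpack-tup (unpackᵗ nts δ as δ' e) e
    unpack (nf-unpack {D} {D'} {bs} {s = s} ns) δ as δ' e with split-∷ D D' δ δ' e
    ... | inj₁ (refl , refl , refl) = s , ns , ≈-reflexive (sym (cast-refl e _))
    ... | inj₂ (inj₁ (μ , refl , refl)) =
      unpack-before δ μ D' (unpack ns δ as (μ ++ bs ++ D') (++-assoc δ (⊗ as ∷ μ) (bs ++ D'))) e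
    ... | inj₂ (inj₂ (μ , refl , refl)) =
      unpack-after D μ δ' (unpack ns (D ++ bs ++ μ) as δ' (sym (++-assoc³ D bs μ (⊗ as ∷ δ')))) e

    unpackᵗ : ∀ {Γ : Cx} {cs} {ts : Tup Γ cs} → Nfᵗ ts →
              ∀ δ as δ' → Γ ≡ δ ++ ⊗ as ∷ δ' → Unpackedᵗ ts δ as δ'
    unpackᵗ [] δ as δ' e = ⊥-elim (nil≢ δ e)
    unpackᵗ (_∷_ {γ₁} {γ₂} {t = t} {ts} nt nts) δ as δ' e with split-++ γ₁ γ₂ δ δ' e
    ... | inj₁ (μ , refl , refl) = record
      { ls = []ᵗ ; t = t ; rs = ts ; ls-nf = [] ; rs-nf = nts
      ; t-unpacked = unpack nt δ as μ refl
      ; cs≡ = refl ; δ≡ = refl ; δ'≡ = refl ; Γ≡ = refl ; ts≅ = H.refl }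
    ... | inj₂ (μ , γ₂≡ , refl) = Unpackedᵗ-∷ nt (unpackᵗ nts μ as δ' γ₂≡)

  mutual
    leaves : Ty A → Cx
    leaves (atom o) = [ atom o ]
    leaves (⊗ as) = leavesᴸ as

    leavesᴸ : List (Ty A) → Cx
    leavesᴸ [] = []
    leavesᴸ (a ∷ as) = leaves a ++ leavesᴸ as

  mutual
    η-long : (a : Ty A) → Term (leaves a) a
    η-long (atom o) = var (atom o)
    η-long (⊗ as) = tup (η-longᵗ as)

    η-longᵗ : (as : List (Ty A)) → Tup (leavesᴸ as) as
    η-longᵗ [] = []ᵗ
    η-longᵗ (a ∷ as) = η-long a ∷ᵗ η-longᵗ as

  data IsAtom : Ty A → Set where
    atom : ∀ o → IsAtom (atom o)

  mutual
    Nf-atomic : ∀ {Γ : Cx} {b} {s : Term Γ b} → All IsAtom Γ → Nf s →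
                Σ (Γ ≡ leaves b) λ e → s ≡ cast e (η-long b)
    Nf-atomic _ (nf-var o) = refl , refl
    Nf-atomic atoms (nf-tup nts) with Nfᵗ-atomic atoms nts
    ... | refl , refl = refl , refl
    Nf-atomic atoms (nf-unpack {δ} _) with ++⁻ʳ δ atoms
    ... | () ∷ _

    Nfᵗ-atomic : ∀ {Γ : Cx} {as} {ts : Tup Γ as} → All IsAtom Γ → Nfᵗ ts →
                 Σ (Γ ≡ leavesᴸ as) λ e → ts ≡ castᵗ e (η-longᵗ as)
    Nfᵗ-atomic _ [] = refl , refl
    Nfᵗ-atomic {ts = _∷ᵗ_ {γ} _ _} atoms (nt ∷ nts)
      with Nf-atomic (++⁻ˡ γ atoms) nt | Nfᵗ-atomic (++⁻ʳ γ atoms) nts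
    ... | refl , refl | refl , refl = refl , refl

  atomic⊎tensor : (γ : Cx) →
                  All IsAtom γ ⊎ (Σ Cx λ δ → Σ Cx λ as → Σ Cx λ δ' → γ ≡ δ ++ ⊗ as ∷ δ')
  atomic⊎tensor [] = inj₁ []
  atomic⊎tensor (atom o ∷ γ) with atomic⊎tensor γ
  ... | inj₁ atoms = inj₁ (atom o ∷ atoms)
  ... | inj₂ (δ , as , δ' , refl) = inj₂ (atom o ∷ δ , as , δ' , refl)
  atomic⊎tensor (⊗ as ∷ γ) = inj₂ ([] , as , γ , refl)

  ⊗-size : Cx → ℕ
  ⊗-size [] = 0
  ⊗-size (atom _ ∷ γ) = ⊗-size γ
  ⊗-size (⊗ as ∷ γ) = suc (⊗-size as + ⊗-size γ)

  ⊗-size-++ : ∀ (γ δ : Cx) → ⊗-size (γ ++ δ) ≡ ⊗-size γ + ⊗-size δ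
  ⊗-size-++ [] δ = refl
  ⊗-size-++ (atom _ ∷ γ) δ = ⊗-size-++ γ δ
  ⊗-size-++ (⊗ as ∷ γ) δ =
    cong suc (trans (cong (⊗-size as +_) (⊗-size-++ γ δ))
                    (sym (+-assoc (⊗-size as) (⊗-size γ) (⊗-size δ))))

  ⊗-size-unpack : ∀ (δ as δ' : Cx) → ⊗-size (δ ++ as ++ δ') < ⊗-size (δ ++ ⊗ as ∷ δ')
  ⊗-size-unpack δ as δ'
    rewrite ⊗-size-++ δ (as ++ δ') | ⊗-size-++ δ (⊗ as ∷ δ') | ⊗-size-++ as δ' =
    +-monoʳ-< (⊗-size δ) (n<1+n (⊗-size as + ⊗-size δ'))

  Nf-unique : ∀ {γ : Cx} {a} {s s' : Term γ a} → Acc _<_ (⊗-size γ) → Nf s → Nf s' → s ≈ s'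
  Nf-unique {γ} _ ns ns' with atomic⊎tensor γ
  Nf-unique _ ns ns' | inj₁ atoms with Nf-atomic atoms ns | Nf-atomic atoms ns'
  ... | e , refl | e' , refl = ≈-reflexive (cast-irrelevant e e' _)
  Nf-unique (acc smaller) ns ns' | inj₂ (δ , as , δ' , refl)
    with unpack ns δ as δ' refl | unpack ns' δ as δ' refl
  ... | N , N-nf , s≈ | N' , N'-nf , s'≈ =
    ≈-trans s≈ (≈-trans (≈-let (Nf-unique (smaller (⊗-size-unpack δ as δ')) N-nf N'-nf) ≈-refl)
                        (≈-sym s'≈))

theorem3p17 : {A : Set} {γ : List (Ty A)} {a : Ty A} (s s' : Term γ a) →
    Normal s → Normal s' → s ≈ s'
theorem3p17 s s' n n' = Nf-unique (<-wellFounded _) (normal⇒Nf s n) (normal⇒Nf s' n')
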